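{- Let $(\mathsf D,\Upsilon)$ be a rank $r$ semistandard $(m,n)$-parking function. Then $\mathrm{std}(\mathsf D,\Upsilon)=(\mathsf D,\varphi)$, where $\varphi$ is the unique bijection from the vertical steps of $\mathsf D$ to $\{1,\dots,m\}$ such that (1) $\varphi(v_i)<\varphi(v_j)$ whenever $\Upsilon(v_i)<\Upsilon(v_j)$, and (2) $\varphi(v_i)<\varphi(v_j)$ whenever $\Upsilon(v_i)=\Upsilon(v_j)$ and $\gamma(v_i)<\gamma(v_j)$.
   Context: Fix coprime positive integers $m,n$ and a positive integer $r$. An $(m,n)$-Dyck path $\mathsf D$ is a lattice path from $(0,m)$ to $(n,0)$ of unit south and east steps staying weakly below $mx+ny=mn$; its vertical steps $v_0,\dots,v_{m-1}$ (top to bottom) have top endpoints $(a_j,m-j)$, identified with $v_j$; $v_j,v_{j+1}$ are consecutive if $a_j=a_{j+1}$. Anderson label: $\gamma(x,y)=mn-mx-ny$. A rank $r$ semistandard $(m,n)$-parking function is $(\mathsf D,\Upsilon)$ with $\Upsilon:\{v_j\}\to\{1,\dots,r\}$, $\Upsilon(v_j)\le\Upsilon(v_{j+1})$ for consecutive steps; weight $\mathbf w=(|\Upsilon^{ -1}(i)|)_{i=1}^r$. An $(m,n)$-parking function is $(\mathsf D,\varphi)$ with $\varphi$ bijective onto $\{1,\dots,m\}$, strictly increasing on consecutive steps; set $\mathrm{PF}_{m,n}$. $(m,r)$-affine composition: $f:\mathbb Z\to\mathbb Z$, $f(x+m)=f(x)+r$, $f^{ -1}([1,r])$ of size $m$,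 distinct mod $m$, sum $m(m+1)/2$; weight $(|f^{ -1}(i)|)_i$; $n$-stable if $f(x+n)\ge f(x)$. $\widetilde S_m$: bijections with $\sigma(x+m)=\sigma(x)+m$, $\sum_{i=1}^m\sigma(i)=m(m+1)/2$. $\mathcal A_{\mathbf w}(\mathsf D,\Upsilon)(x)=\tilde f(x+k)$, where $\tilde f(\gamma(v_j)+pm)=\Upsilon(v_j)+pr$ ($p\in\mathbb Z$) and $\sum_j(\gamma(v_j)-(j+1))=km$; $\mathcal A=\mathcal A_{(1^m)}$ is a bijection from $\mathrm{PF}_{m,n}$ onto $n$-stable elements of $\widetilde S_m$. $f_{\mathbf w}(x)=i$ for $w_1+\dots+w_{i-1}<x\le w_1+\dots+w_i$, $f_{\mathbf w}(x+m)=f_{\mathbf w}(x)+r$. For $f$ of weight $\mathbf w$ there is a unique $\sigma\in\widetilde S_m$ with $f=f_{\mathbf w}\circ\sigma$ and $\sigma^{ -1}(a)<\sigma^{ -1}(b)$ whenever $a<b$, $f_{\mathbf w}(a)=f_{\mathbf w}(b)$ ($n$-stable if $f$ is), and $\mathrm{std}(\mathsf D,\Upsilon)=\mathcal A^{ -1}(\sigma)$ for $f=\mathcal A_{\mathbf w}(\mathsf D,\Upsilon)$. -}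

module Defs where

open import Data.Nat as ℕ using (ℕ; zero; suc; NonZero)
open import Data.Nat.Coprimality using (Coprime)
open import Data.Bool using (Bool; true; false; if_then_else_)
open import Data.Fin as Fin using (Fin; toℕ)
open import Data.Integer as ℤ using (ℤ; +_; _/ℕ_; _%ℕ_)
open import Data.Product using (Σ; ∃; _×_; _,_)
open import Relation.Nullary.Decidable using (⌊_⌋)
open import Relation.Binary.PropositionalEquality using (_≡_)

sumFinℕ : (m : ℕ) → (Fin m → ℕ) → ℕ
sumFinℕ zero    g = 0
sumFinℕ (suc m) g = g Fin.zero ℕ.+ sumFinℕ m (λ j → g (Fin.suc j))

sumFinℤ : (m : ℕ) → (Fin m → ℤ) → ℤ
sumFinℤ zero    g = + 0
sumFinℤ (suc m) g = g Fin.zero ℤ.+ sumFinℤ m (λ j → g (Fin.suc j))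

countFin : (m : ℕ) → (Fin m → Bool) → ℕ
countFin m P = sumFinℕ m (λ j → if P j then 1 else 0)

sumTo : ℕ → (ℕ → ℕ) → ℕ
sumTo zero    g = 0
sumTo (suc k) g = sumTo k g ℕ.+ g (suc k)

-- (m,n)-Dyck paths, encoded by the x-coordinates a_0,…,a_{m-1} of the
-- top endpoints (a_j, m-j) of the vertical steps v_0,…,v_{m-1}.
-- The lattice path from (0,m) to (n,0) is determined by these; it stays
-- weakly below mx+ny=mn iff every top endpoint does: m a_j + n (m-j) ≤ mn,
-- i.e. m a_j ≤ n j; and the a_j are weakly increasing.

record DyckPath (m n : ℕ) : Set where
  field
    a        : Fin m → ℕ
    monotone : ∀ i j → toℕ i ℕ.≤ toℕ j → a i ℕ.≤ a j
    below    : ∀ j → m ℕ.* a j ℕ.≤ n ℕ.* toℕ j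
open DyckPath public

γ : ∀ {m n} → DyckPath m n → Fin m → ℤ
γ {m} {n} D j = + (m ℕ.* n) ℤ.- + (m ℕ.* a D j) ℤ.- + (n ℕ.* (m ℕ.∸ toℕ j))

Consecutive : ∀ {m n} → DyckPath m n → Fin m → Fin m → Set
Consecutive D i j = toℕ j ≡ suc (toℕ i) × a D i ≡ a D j

IsSemistandard : ∀ {m n} (r : ℕ) → DyckPath m n → (Fin m → ℕ) → Set
IsSemistandard {m} r D Υ =
  (∀ j → 1 ℕ.≤ Υ j × Υ j ℕ.≤ r) ×
  (∀ i j → Consecutive D i j → Υ i ℕ.≤ Υ j)

IsParkingLabel : ∀ {m n} → DyckPath m n → (Fin m → ℕ) → Set
IsParkingLabel {m} D φ =
  (∀ j → 1 ℕ.≤ φ j × φ j ℕ.≤ m) ×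
  (∀ i j → φ i ≡ φ j → i ≡ j) ×
  (∀ x → 1 ℕ.≤ x → x ℕ.≤ m → ∃ λ j → φ j ≡ x) ×
  (∀ i j → Consecutive D i j → φ i ℕ.< φ j)

weight : (m : ℕ) → (Fin m → ℕ) → ℕ → ℕ
weight m Υ i = countFin m (λ j → ⌊ Υ j ℕ.≟ i ⌋)

W : (m : ℕ) → (Fin m → ℕ) → ℕ → ℕ
W m Υ i = sumTo i (weight m Υ)

-- f_w on {1,…,m}: f_w(s) = i for W_{i-1} < s ≤ W_i (1 ≤ i ≤ r),
-- computed as i = #{ i' ∈ {1,…,r} : W_{i'-1} < s }.
fw₀ : (m r : ℕ) → (Fin m → ℕ) → ℕ → ℕ
fw₀ m r Υ s = countFin r (λ i → ⌊ W m Υ (toℕ i) ℕ.<? s ⌋)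

-- f_w on ℤ, extended by f_w(x + m) = f_w(x) + r:
-- write x - 1 = q m + t with 0 ≤ t < m, then f_w(x) = f_w(t+1) + q r.
fw : (m r : ℕ) .{{_ : NonZero m}} → (Fin m → ℕ) → ℤ → ℤ
fw m r Υ x =
  + fw₀ m r Υ (suc ((x ℤ.- + 1) %ℕ m)) ℤ.+ ((x ℤ.- + 1) /ℕ m) ℤ.* + r

-- the shift k with Σ_j (γ(v_j) - (j+1)) = k m

shiftK : ∀ {m n} .{{_ : NonZero m}} → DyckPath m n → ℤ
shiftK {m} D = sumFinℤ m (λ j → γ D j ℤ.- + suc (toℕ j)) /ℕ m

-- g = A_w(D,Υ) (rank r, labels Υ):  g(x) = f̃(x+k) with
-- f̃(γ(v_j) + p m) = Υ(v_j) + p r.  Since the γ(v_j) are distinct mod m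
-- (m,n coprime) this determines g on all of ℤ; we express "g ≡ A_w(D,Υ)"
-- by its defining values:  g(γ(v_j) + p m - k) = Υ(v_j) + p r.

IsA : ∀ {m n} .{{_ : NonZero m}} (r : ℕ) → DyckPath m n → (Fin m → ℕ) →
      (ℤ → ℤ) → Set
IsA {m} r D Υ g = ∀ (j : Fin m) (p : ℤ) →
  g (γ D j ℤ.+ p ℤ.* + m ℤ.- shiftK D) ≡ + Υ j ℤ.+ p ℤ.* + r

sumAff : (m : ℕ) → (ℤ → ℤ) → ℤ
sumAff m σ = sumFinℤ m (λ j → σ (+ suc (toℕ j)))

IsAffinePerm : (m : ℕ) → (ℤ → ℤ) → Set
IsAffinePerm m σ =
  (∀ x y → σ x ≡ σ y → x ≡ y) ×
  (∀ y → ∃ λ x → σ x ≡ y) ×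
  (∀ x → σ (x ℤ.+ + m) ≡ σ x ℤ.+ + m) ×
  (+ 2 ℤ.* sumAff m σ ≡ + (m ℕ.* suc m))      -- Σ σ(i) = m(m+1)/2

-- σ is the standardization permutation of f = A_w(D,Υ):
-- σ ∈ S̃_m, f = f_w ∘ σ, and σ⁻¹(a) < σ⁻¹(b) whenever a < b and
-- f_w(a) = f_w(b)  (stated with a = σ x, b = σ y).
IsStdPerm : ∀ {m n} .{{_ : NonZero m}} (r : ℕ) → DyckPath m n →
            (Fin m → ℕ) → (ℤ → ℤ) → Set
IsStdPerm {m} r D Υ σ =
  IsAffinePerm m σ ×
  IsA r D Υ (λ x → fw m r Υ (σ x)) ×
  (∀ x y → σ x ℤ.< σ y → fw m r Υ (σ x) ≡ fw m r Υ (σ y) → x ℤ.< y)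

IsStdLabel : ∀ {m n} → DyckPath m n → (Fin m → ℕ) → (Fin m → ℕ) → Set
IsStdLabel {m} D Υ φ =
  (∀ j → 1 ℕ.≤ φ j × φ j ℕ.≤ m) ×
  (∀ i j → φ i ≡ φ j → i ≡ j) ×
  (∀ x → 1 ℕ.≤ x → x ℕ.≤ m → ∃ λ j → φ j ≡ x) ×
  (∀ i j → Υ i ℕ.< Υ j → φ i ℕ.< φ j) ×
  (∀ i j → Υ i ≡ Υ j → γ D i ℤ.< γ D j → φ i ℕ.< φ j)

{-# OPTIONS --safe #-}

-- Since m and n are coprime, the Anderson labels γ(v_j) are pairwise distinct, so ordering the
-- vertical steps lexicographically by (Υ, γ) is a strict total order ≺, and φ is its rank function:
-- the unique ≺-monotone bijection onto {1,…,m}. Consecutive steps have weakly increasing Υ and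
-- strictly increasing γ, which makes φ a parking labelling. For the standardization σ of
-- A_w(D,Υ), put ψ(v_j) = σ(γ(v_j) − k). Then f_w(ψ(v_j)) = Υ(v_j) ∈ {1,…,r}, which forces
-- ψ(v_j) ∈ {1,…,m}; injectivity of σ, monotonicity of f_w and the order condition on the fibres
-- of f_w make ψ a ≺-monotone bijection, hence ψ = φ, and periodicity of σ gives A(D,φ) = σ.
module Submission where

open import Data.Bool using (Bool; if_then_else_)
open import Data.Empty using (⊥-elim)
open import Data.Fin as Fin using (Fin; toℕ)
import Data.Fin.Properties as Finₚ
open import Data.Integer as ℤ using (ℤ; +_; -[1+_])
open import Data.Integer.DivMod using (n%ℕd<d; a≡a%ℕn+[a/ℕn]*n)
import Data.Integer.Properties as ℤₚ
open import Data.Integer.Tactic.RingSolver using (solve-∀)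
open import Data.Nat as ℕ using (ℕ; zero; suc; _+_; _*_; _∸_; _≤_; _<_; z≤n; s≤s; NonZero)
open import Data.Nat.Coprimality using (Coprime; coprime-divisor)
open import Data.Nat.Divisibility using (_∣_; m∣m*n; ∣m+n∣m⇒∣n; >⇒∤)
open import Data.Nat.Properties
open import Algebra.Properties.CommutativeSemigroup +-commutativeSemigroup
  using () renaming (interchange to +-interchange)
open import Data.Product using (Σ; ∃; _×_; _,_; proj₁; proj₂)
open import Data.Product.Relation.Binary.Lex.Strict using (×-Lex; ×-isStrictTotalOrder)
open import Data.Sum using (_⊎_; inj₁; inj₂)
open import Data.Unit using (tt)
open import Function using (id; _∘_; _on_)
open import Level using (Level; 0ℓ)
open import Relation.Binary using (Rel; IsStrictTotalOrder; Trichotomous; tri<; tri≈; tri>)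
import Relation.Binary.PropositionalEquality as ≡
open import Relation.Binary.PropositionalEquality
  using (_≡_; _≢_; refl; sym; trans; cong; cong₂; subst; subst₂; resp₂; module ≡-Reasoning)
open import Relation.Nullary using (¬_; Dec; yes; no; contradiction)
open import Relation.Nullary.Decidable using (⌊_⌋; _⊎-dec_)
open import Relation.Unary using (Pred; Decidable)

open import Defs

private variable
  ℓ ℓ′ : Level

sumFinℕ-cong : ∀ m {f g : Fin m → ℕ} → (∀ i → f i ≡ g i) → sumFinℕ m f ≡ sumFinℕ m g
sumFinℕ-cong zero    f≗g = refl
sumFinℕ-cong (suc m) f≗g = cong₂ _+_ (f≗g Fin.zero) (sumFinℕ-cong m (λ i → f≗g (Fin.suc i)))

sumFinℕ-distrib-+ : ∀ m (f g : Fin m → ℕ) →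
                    sumFinℕ m (λ i → f i + g i) ≡ sumFinℕ m f + sumFinℕ m g
sumFinℕ-distrib-+ zero    f g = refl
sumFinℕ-distrib-+ (suc m) f g =
  trans (cong (λ s → f Fin.zero + g Fin.zero + s) (sumFinℕ-distrib-+ m _ _))
        (+-interchange (f Fin.zero) (g Fin.zero) _ _)

sumFinℕ-mono-≤ : ∀ m {f g : Fin m → ℕ} → (∀ i → f i ≤ g i) → sumFinℕ m f ≤ sumFinℕ m g
sumFinℕ-mono-≤ zero    f≤g = z≤n
sumFinℕ-mono-≤ (suc m) f≤g = +-mono-≤ (f≤g Fin.zero) (sumFinℕ-mono-≤ m (λ i → f≤g (Fin.suc i)))

sumFinℕ-mono-< : ∀ m {f g : Fin m → ℕ} → (∀ i → f i ≤ g i) → ∀ i₀ → f i₀ < g i₀ →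
                 sumFinℕ m f < sumFinℕ m g
sumFinℕ-mono-< (suc m) f≤g Fin.zero     f<g =
  +-mono-<-≤ f<g (sumFinℕ-mono-≤ m (λ i → f≤g (Fin.suc i)))
sumFinℕ-mono-< (suc m) f≤g (Fin.suc i₀) f<g =
  +-mono-≤-< (f≤g Fin.zero) (sumFinℕ-mono-< m (λ i → f≤g (Fin.suc i)) i₀ f<g)

sumFinℕ-const : ∀ m c → sumFinℕ m (λ _ → c) ≡ m * c
sumFinℕ-const zero    c = refl
sumFinℕ-const (suc m) c = cong (λ s → c + s) (sumFinℕ-const m c)

indicator : Bool → ℕ
indicator b = if b then 1 else 0

module _ {A : Set ℓ} {B : Set ℓ′} where

  indicator-mono : (a? : Dec A) (b? : Dec B) → (A → B) → indicator ⌊ a? ⌋ ≤ indicator ⌊ b? ⌋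
  indicator-mono (yes a) (yes _) _   = ≤-refl
  indicator-mono (yes a) (no ¬b) a→b = contradiction (a→b a) ¬b
  indicator-mono (no _)  _       _   = z≤n

  indicator-mono-< : (a? : Dec A) (b? : Dec B) → ¬ A → B → indicator ⌊ a? ⌋ < indicator ⌊ b? ⌋
  indicator-mono-< (yes a) _       ¬a _ = contradiction a ¬a
  indicator-mono-< (no _)  (yes _) _  _ = s≤s z≤n
  indicator-mono-< (no _)  (no ¬b) _  b = contradiction b ¬b

  indicator-⊎ : (a? : Dec A) (b? : Dec B) → (A → ¬ B) →
                indicator ⌊ a? ⊎-dec b? ⌋ ≡ indicator ⌊ a? ⌋ + indicator ⌊ b? ⌋
  indicator-⊎ (yes a) (yes b) a→¬b = contradiction b (a→¬b a)
  indicator-⊎ (yes _) (no _)  _    = refl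
  indicator-⊎ (no _)  (yes _) _    = refl
  indicator-⊎ (no _)  (no _)  _    = refl

count : ∀ {m} {P : Pred (Fin m) ℓ} → Decidable P → ℕ
count {m = m} P? = countFin m (λ i → ⌊ P? i ⌋)

module _ {m : ℕ} {P : Pred (Fin m) ℓ} {Q : Pred (Fin m) ℓ′} where

  count-mono : (P? : Decidable P) (Q? : Decidable Q) → (∀ i → P i → Q i) → count P? ≤ count Q?
  count-mono P? Q? P⊆Q = sumFinℕ-mono-≤ m (λ i → indicator-mono (P? i) (Q? i) (P⊆Q i))

  count-mono-< : (P? : Decidable P) (Q? : Decidable Q) → (∀ i → P i → Q i) →
                 ∀ i₀ → ¬ P i₀ → Q i₀ → count P? < count Q?
  count-mono-< P? Q? P⊆Q i₀ ¬Pi₀ Qi₀ =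
    sumFinℕ-mono-< m (λ i → indicator-mono (P? i) (Q? i) (P⊆Q i))
                   i₀ (indicator-mono-< (P? i₀) (Q? i₀) ¬Pi₀ Qi₀)

  count-⊎ : (P? : Decidable P) (Q? : Decidable Q) → (∀ i → P i → ¬ Q i) →
            count (λ i → P? i ⊎-dec Q? i) ≡ count P? + count Q?
  count-⊎ P? Q? disjoint = trans (sumFinℕ-cong m (λ i → indicator-⊎ (P? i) (Q? i) (disjoint i)))
                                 (sumFinℕ-distrib-+ m _ _)

module _ {m : ℕ} {P : Pred (Fin m) ℓ} {Q : Pred (Fin m) ℓ′} where

  count-cong : (P? : Decidable P) (Q? : Decidable Q) →
               (∀ i → P i → Q i) → (∀ i → Q i → P i) → count P? ≡ count Q?
  count-cong P? Q? P⊆Q Q⊆P = ≤-antisym (count-mono P? Q? P⊆Q) (count-mono Q? P? Q⊆P)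

module _ {m : ℕ} {P : Pred (Fin m) ℓ} (P? : Decidable P) where

  count-≤ : count P? ≤ m
  count-≤ = begin
    count P?                  ≤⟨ count-mono P? (λ _ → yes tt) _ ⟩
    sumFinℕ m (λ _ → 1)       ≡⟨ sumFinℕ-const m 1 ⟩
    m * 1                     ≡⟨ *-identityʳ m ⟩
    m                         ∎
    where open ≤-Reasoning

  count-< : ∀ i₀ → ¬ P i₀ → count P? < m
  count-< i₀ ¬Pi₀ = begin-strict
    count P?                  <⟨ count-mono-< P? (λ _ → yes tt) _ i₀ ¬Pi₀ tt ⟩
    sumFinℕ m (λ _ → 1)       ≡⟨ sumFinℕ-const m 1 ⟩
    m * 1                     ≡⟨ *-identityʳ m ⟩
    m                         ∎
    where open ≤-Reasoning

  count-∅ : (∀ i → ¬ P i) → count P? ≡ 0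
  count-∅ ∅ = n≤0⇒n≡0 (begin
    count P?                  ≤⟨ count-mono P? (λ _ → no id) (λ i → ⊥-elim ∘ ∅ i) ⟩
    sumFinℕ m (λ _ → 0)       ≡⟨ sumFinℕ-const m 0 ⟩
    m * 0                     ≡⟨ *-zeroʳ m ⟩
    0                         ∎)
    where open ≤-Reasoning

count-singleton : ∀ {m} (i₀ : Fin m) → count (Fin._≟ i₀) ≡ 1
count-singleton {suc m} Fin.zero     =
  cong suc (count-∅ {m = m} (λ i → Fin.suc i Fin.≟ Fin.zero) (λ i ()))
count-singleton {suc m} (Fin.suc i₀) =
  trans (count-cong (λ i → Fin.suc i Fin.≟ Fin.suc i₀) (Fin._≟ i₀)
                    (λ i → Finₚ.suc-injective) (λ i → cong Fin.suc))
        (count-singleton i₀)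

toFin : ∀ {m y} → 1 ≤ y → y ≤ m → Fin m
toFin {y = suc y} _ y<m = Fin.fromℕ< y<m

suc-toℕ-toFin : ∀ {m y} (1≤y : 1 ≤ y) (y≤m : y ≤ m) → suc (toℕ (toFin 1≤y y≤m)) ≡ y
suc-toℕ-toFin {y = suc y} _ y<m = cong suc (Finₚ.toℕ-fromℕ< y<m)

toFin-injective : ∀ {m y y′} (1≤y : 1 ≤ y) (y≤m : y ≤ m) (1≤y′ : 1 ≤ y′) (y′≤m : y′ ≤ m) →
                  toFin 1≤y y≤m ≡ toFin 1≤y′ y′≤m → y ≡ y′
toFin-injective 1≤y y≤m 1≤y′ y′≤m eq =
  trans (sym (suc-toℕ-toFin 1≤y y≤m)) (trans (cong (suc ∘ toℕ) eq) (suc-toℕ-toFin 1≤y′ y′≤m))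

injective⇒surjective : ∀ {m} (ψ : Fin m → ℕ) → (∀ j → 1 ≤ ψ j × ψ j ≤ m) →
                       (∀ i j → ψ i ≡ ψ j → i ≡ j) →
                       ∀ x → 1 ≤ x → x ≤ m → ∃ λ j → ψ j ≡ x
injective⇒surjective {zero} ψ _ _ x 1≤x x≤0 = contradiction (≤-trans 1≤x x≤0) λ ()
injective⇒surjective {suc m} ψ ψ-range ψ-inj x 1≤x x≤m with Finₚ.any? (λ j → ψ j ℕ.≟ x)
... | yes hit  = hit
... | no  miss = contradiction (Finₚ.injective⇒≤ {f = punched} punched-injective) (1+n≰n {m})
  where
  x̂ : Fin (suc m)
  x̂ = toFin 1≤x x≤m
  ψ̂ : Fin (suc m) → Fin (suc m)
  ψ̂ j = toFin (proj₁ (ψ-range j)) (proj₂ (ψ-range j))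
  x̂≢ψ̂ : ∀ j → x̂ ≢ ψ̂ j
  x̂≢ψ̂ j eq = miss (j , sym (toFin-injective 1≤x x≤m (proj₁ (ψ-range j)) (proj₂ (ψ-range j)) eq))
  punched : Fin (suc m) → Fin m
  punched j = Fin.punchOut (x̂≢ψ̂ j)
  punched-injective : ∀ {i j} → punched i ≡ punched j → i ≡ j
  punched-injective {i} {j} eq = ψ-inj i j (toFin-injective _ _ _ _
                                   (Finₚ.punchOut-injective (x̂≢ψ̂ i) (x̂≢ψ̂ j) eq))

module _ {m : ℕ} (ψ : Fin m → ℕ) (ψ-range : ∀ j → 1 ≤ ψ j × ψ j ≤ m)
         (ψ-inj : ∀ i j → ψ i ≡ ψ j → i ≡ j)
         (ψ-surj : ∀ x → 1 ≤ x → x ≤ m → ∃ λ j → ψ j ≡ x) where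

  count-below : ∀ v → v < m → count (λ i → ψ i <? suc v) ≡ v
  count-below zero    _     = count-∅ _ (λ i ψi<1 → <⇒≱ ψi<1 (proj₁ (ψ-range i)))
  count-below (suc v) 1+v<m with ψ-surj (suc v) (s≤s z≤n) (<⇒≤ 1+v<m)
  ... | i₀ , ψi₀≡1+v = begin
    count (λ i → ψ i <? suc (suc v))
      ≡⟨ count-cong _ below-or-i₀? split merge ⟩
    count below-or-i₀?
      ≡⟨ count-⊎ _ _ disjoint ⟩
    count (λ i → ψ i <? suc v) + count (Fin._≟ i₀)
      ≡⟨ cong₂ _+_ (count-below v v<m) (count-singleton i₀) ⟩
    v + 1
      ≡⟨ +-comm v 1 ⟩
    suc v
      ∎
    where
    open ≡-Reasoning
    v<m : v < m
    v<m = <-trans (n<1+n v) 1+v<m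
    below-or-i₀? : Decidable (λ i → ψ i < suc v ⊎ i ≡ i₀)
    below-or-i₀? i = (ψ i <? suc v) ⊎-dec (i Fin.≟ i₀)
    split : ∀ i → ψ i < suc (suc v) → ψ i < suc v ⊎ i ≡ i₀
    split i (s≤s ψi≤1+v) with m≤n⇒m<n∨m≡n ψi≤1+v
    ... | inj₁ ψi<1+v = inj₁ ψi<1+v
    ... | inj₂ ψi≡1+v = inj₂ (ψ-inj i i₀ (trans ψi≡1+v (sym ψi₀≡1+v)))
    merge : ∀ i → ψ i < suc v ⊎ i ≡ i₀ → ψ i < suc (suc v)
    merge i (inj₁ ψi<1+v) = m<n⇒m<1+n ψi<1+v
    merge i (inj₂ refl)   = s≤s (≤-reflexive ψi₀≡1+v)
    disjoint : ∀ i → ψ i < suc v → ¬ i ≡ i₀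
    disjoint i ψi<1+v refl = <-irrefl ψi₀≡1+v ψi<1+v

module _ {a b ℓ₁ ℓ₂} {A : Set a} {B : Set b} {_≈_ : Rel B ℓ₁} {_<_ : Rel B ℓ₂} where

  injective⇒isStrictTotalOrder : IsStrictTotalOrder _≈_ _<_ → (f : A → B) →
                                 (∀ x y → f x ≈ f y → x ≡ y) → IsStrictTotalOrder _≡_ (_<_ on f)
  injective⇒isStrictTotalOrder <-sto f f-injective = record
    { isStrictPartialOrder = record
      { isEquivalence = ≡.isEquivalence
      ; irrefl        = λ { refl → <.irrefl <.Eq.refl }
      ; trans         = <.trans
      ; <-resp-≈      = resp₂ (_<_ on f)
      }
    ; compare = compare-on-f
    }
    where
    module < = IsStrictTotalOrder <-sto
    compare-on-f : Trichotomous _≡_ (_<_ on f)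
    compare-on-f x y with <.compare (f x) (f y)
    ... | tri< fx<fy fx≉fy fx≯fy = tri< fx<fy (λ { refl → fx≉fy <.Eq.refl }) fx≯fy
    ... | tri≈ fx≮fy fx≈fy fx≯fy = tri≈ fx≮fy (f-injective x y fx≈fy) fx≯fy
    ... | tri> fx≮fy fx≉fy fx>fy = tri> fx≮fy (λ { refl → fx≉fy <.Eq.refl }) fx>fy

module Ranking {m : ℕ} {_≺_ : Rel (Fin m) ℓ} (≺-isStrictTotalOrder : IsStrictTotalOrder _≡_ _≺_)
  where

  open IsStrictTotalOrder ≺-isStrictTotalOrder
    using (compare; irrefl) renaming (trans to ≺-trans; _<?_ to _≺?_)

  rank : Fin m → ℕ
  rank j = suc (count (_≺? j))

  rank-range : ∀ j → 1 ≤ rank j × rank j ≤ m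
  rank-range j = s≤s z≤n , count-< (_≺? j) j (irrefl refl)

  rank-strictMono : ∀ {i j} → i ≺ j → rank i < rank j
  rank-strictMono {i} {j} i≺j =
    s≤s (count-mono-< (_≺? i) (_≺? j) (λ k k≺i → ≺-trans k≺i i≺j) i (irrefl refl) i≺j)

  rank-injective : ∀ i j → rank i ≡ rank j → i ≡ j
  rank-injective i j eq with compare i j
  ... | tri< i≺j _ _ = contradiction eq (<⇒≢ (rank-strictMono i≺j))
  ... | tri≈ _ i≡j _ = i≡j
  ... | tri> _ _ j≺i = contradiction (sym eq) (<⇒≢ (rank-strictMono j≺i))

  rank-surjective : ∀ x → 1 ≤ x → x ≤ m → ∃ λ j → rank j ≡ x
  rank-surjective = injective⇒surjective rank rank-range rank-injective

  strictMono⇒≡rank : (ψ : Fin m → ℕ) → (∀ j → 1 ≤ ψ j × ψ j ≤ m) →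
                     (∀ i j → ψ i ≡ ψ j → i ≡ j) → (∀ x → 1 ≤ x → x ≤ m → ∃ λ j → ψ j ≡ x) →
                     (∀ {i j} → i ≺ j → ψ i < ψ j) → ∀ j → ψ j ≡ rank j
  strictMono⇒≡rank ψ ψ-range ψ-inj ψ-surj ψ-mono j with ψ j in ψj≡ | ψ-range j
  -- no clause for ψ j = 0: the abstracted bound 1 ≤ ψ j makes it absurd
  ... | suc v | _ , v<m = cong suc (begin
    v                                ≡⟨ count-below ψ ψ-range ψ-inj ψ-surj v v<m ⟨
    count (λ i → ψ i <? suc v)       ≡⟨ count-cong _ (_≺? j) reflect preserve ⟩
    count (_≺? j)                    ∎)
    where
    open ≡-Reasoning
    preserve : ∀ i → i ≺ j → ψ i < suc v
    preserve i i≺j = subst (ψ i <_) ψj≡ (ψ-mono i≺j)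
    reflect : ∀ i → ψ i < suc v → i ≺ j
    reflect i ψi<ψj with compare i j
    ... | tri< i≺j _ _ = i≺j
    ... | tri≈ _ refl _ = contradiction ψj≡ (<⇒≢ ψi<ψj)
    ... | tri> _ _ j≺i = contradiction (subst (_< ψ i) ψj≡ (ψ-mono j≺i)) (<-asym ψi<ψj)

module _ {σ : ℤ → ℤ} {M N : ℤ} (σ-periodic : ∀ x → σ (x ℤ.+ M) ≡ σ x ℤ.+ N) where

  private
    periodic-+ℕ* : ∀ x k → σ (x ℤ.+ + k ℤ.* M) ≡ σ x ℤ.+ + k ℤ.* N
    periodic-+ℕ* x zero    = trans (cong σ (ℤₚ.+-identityʳ x)) (sym (ℤₚ.+-identityʳ (σ x)))
    periodic-+ℕ* x (suc k) = begin
      σ (x ℤ.+ + suc k ℤ.* M)        ≡⟨ cong σ (unfold x (+ k) M) ⟩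
      σ ((x ℤ.+ + k ℤ.* M) ℤ.+ M)    ≡⟨ σ-periodic _ ⟩
      σ (x ℤ.+ + k ℤ.* M) ℤ.+ N      ≡⟨ cong (ℤ._+ N) (periodic-+ℕ* x k) ⟩
      (σ x ℤ.+ + k ℤ.* N) ℤ.+ N      ≡⟨ unfold (σ x) (+ k) N ⟨
      σ x ℤ.+ + suc k ℤ.* N          ∎
      where
      open ≡-Reasoning
      unfold : ∀ y K L → y ℤ.+ (+ 1 ℤ.+ K) ℤ.* L ≡ (y ℤ.+ K ℤ.* L) ℤ.+ L
      unfold = solve-∀

  periodic-+* : ∀ x p → σ (x ℤ.+ p ℤ.* M) ≡ σ x ℤ.+ p ℤ.* N
  periodic-+* x (+ k)    = periodic-+ℕ* x k
  periodic-+* x -[1+ k ] = begin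
    σ y                              ≡⟨ add-sub (σ y) K N ⟩
    σ y ℤ.+ K ℤ.* N ℤ.- K ℤ.* N      ≡⟨ cong (ℤ._- K ℤ.* N) (periodic-+ℕ* y (suc k)) ⟨
    σ (y ℤ.+ K ℤ.* M) ℤ.- K ℤ.* N    ≡⟨ cong (λ z → σ z ℤ.- K ℤ.* N) (sub-add x K M) ⟩
    σ x ℤ.- K ℤ.* N                  ≡⟨ sub≡+neg (σ x) K N ⟩
    σ x ℤ.+ -[1+ k ] ℤ.* N           ∎
    where
    open ≡-Reasoning
    K = + suc k
    y = x ℤ.+ -[1+ k ] ℤ.* M
    add-sub : ∀ z K L → z ≡ z ℤ.+ K ℤ.* L ℤ.- K ℤ.* L
    add-sub = solve-∀
    sub-add : ∀ z K L → z ℤ.+ (ℤ.- K) ℤ.* L ℤ.+ K ℤ.* L ≡ z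
    sub-add = solve-∀
    sub≡+neg : ∀ z K L → z ℤ.- K ℤ.* L ≡ z ℤ.+ (ℤ.- K) ℤ.* L
    sub≡+neg = solve-∀

a+q*r≡b⇒q≡0 : ∀ {r a b} q → 1 ≤ a → a ≤ r → 1 ≤ b → b ≤ r → + a ℤ.+ q ℤ.* + r ≡ + b → q ≡ + 0
a+q*r≡b⇒q≡0             (+ zero)   _   _   _   _   _  = refl
a+q*r≡b⇒q≡0 {r} {a} {b} (+ suc k)  1≤a _   _   b≤r eq =
  contradiction (ℤₚ.+-injective (trans (cong (ℤ._+_ (+ a)) (ℤₚ.pos-* (suc k) r)) eq))
                (>⇒≢ b<a+[1+k]r)
  where
  b<a+[1+k]r : b < a + suc k * r
  b<a+[1+k]r = ≤-<-trans b≤r (+-mono-≤ 1≤a (m≤m+n r (k * r)))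
a+q*r≡b⇒q≡0 {r} {a} {b} -[1+ k ] _   a≤r 1≤b _   eq = contradiction (ℤₚ.drop‿+≤+ b≤0) (<⇒≱ 1≤b)
  where
  open ≡-Reasoning
  N = suc k * r
  b≡-[N∸a] : + b ≡ ℤ.- + (N ∸ a)
  b≡-[N∸a] = begin
    + b                         ≡⟨ eq ⟨
    + a ℤ.+ -[1+ k ] ℤ.* + r    ≡⟨ cong (ℤ._+_ (+ a)) (ℤₚ.neg-distribˡ-* (+ suc k) (+ r)) ⟨
    + a ℤ.+ ℤ.- (+ suc k ℤ.* + r)  ≡⟨ cong (λ z → + a ℤ.+ ℤ.- z) (ℤₚ.pos-* (suc k) r) ⟨
    + a ℤ.+ ℤ.- + N             ≡⟨ ℤₚ.m-n≡m⊖n a N ⟩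
    a ℤ.⊖ N                     ≡⟨ ℤₚ.⊖-≤ (≤-trans a≤r (m≤m+n r (k * r))) ⟩
    ℤ.- + (N ∸ a)               ∎
  b≤0 : + b ℤ.≤ + 0
  b≤0 = subst (ℤ._≤ + 0) (sym b≡-[N∸a]) ℤₚ.neg-≤-pos

module _ {m : ℕ} (r : ℕ) (Υ : Fin m → ℕ) where

  W<? : ∀ s → Decidable (λ (i : Fin r) → W m Υ (toℕ i) < s)
  W<? s i = W m Υ (toℕ i) <? s

  fw₀-mono : ∀ {s s′} → s ≤ s′ → fw₀ m r Υ s ≤ fw₀ m r Υ s′
  fw₀-mono {s} {s′} s≤s′ = count-mono (W<? s) (W<? s′) (λ i W<s → <-≤-trans W<s s≤s′)

-- The lower bound is definitional: W m Υ 0 = 0 < suc t, so block 0 is always counted.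
fw₀-range : ∀ {m} r .{{_ : NonZero r}} (Υ : Fin m → ℕ) t →
            1 ≤ fw₀ m r Υ (suc t) × fw₀ m r Υ (suc t) ≤ r
fw₀-range (suc r) Υ t = s≤s z≤n , count-≤ (W<? (suc r) Υ (suc t))

fw-preimage : ∀ {m r} .{{_ : NonZero m}} .{{_ : NonZero r}} (Υ : Fin m → ℕ) s {b} →
              1 ≤ b → b ≤ r → fw m r Υ s ≡ + b →
              ∃ λ t → s ≡ + suc t × t < m × fw₀ m r Υ (suc t) ≡ b
fw-preimage {m} {r} Υ s {b} 1≤b b≤r fw≡b = t , s≡1+t , n%ℕd<d (s ℤ.- + 1) m , ℤₚ.+-injective fw₀≡b
  where
  open ≡-Reasoning
  t = (s ℤ.- + 1) ℤ.%ℕ m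
  q = (s ℤ.- + 1) ℤ./ℕ m
  q≡0 : q ≡ + 0
  q≡0 = a+q*r≡b⇒q≡0 q (proj₁ (fw₀-range r Υ t)) (proj₂ (fw₀-range r Υ t)) 1≤b b≤r fw≡b
  fw₀≡b : + fw₀ m r Υ (suc t) ≡ + b
  fw₀≡b = begin
    + fw₀ m r Υ (suc t)                     ≡⟨ ℤₚ.+-identityʳ _ ⟨
    + fw₀ m r Υ (suc t) ℤ.+ + 0 ℤ.* + r     ≡⟨ cong (λ z → + fw₀ m r Υ (suc t) ℤ.+ z ℤ.* + r) q≡0 ⟨
    fw m r Υ s                              ≡⟨ fw≡b ⟩
    + b                                     ∎
  s≡1+t : s ≡ + suc t
  s≡1+t = begin
    s                                   ≡⟨ sub-add s ⟩
    (s ℤ.- + 1) ℤ.+ + 1                 ≡⟨ cong (ℤ._+ + 1) (a≡a%ℕn+[a/ℕn]*n (s ℤ.- + 1) m) ⟩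
    (+ t ℤ.+ q ℤ.* + m) ℤ.+ + 1         ≡⟨ cong (λ z → (+ t ℤ.+ z ℤ.* + m) ℤ.+ + 1) q≡0 ⟩
    (+ t ℤ.+ + 0 ℤ.* + m) ℤ.+ + 1       ≡⟨ collapse (+ t) (+ m) ⟩
    + suc t                             ∎
    where
    sub-add : ∀ z → z ≡ (z ℤ.- + 1) ℤ.+ + 1
    sub-add = solve-∀
    collapse : ∀ T L → (T ℤ.+ + 0 ℤ.* L) ℤ.+ + 1 ≡ + 1 ℤ.+ T
    collapse = solve-∀

module _ {m n r : ℕ} .{{_ : NonZero m}} (D : DyckPath m n) {Υ : Fin m → ℕ} {g : ℤ → ℤ} where

  IsA⇒base : IsA r D Υ g → ∀ j → g (γ D j ℤ.- shiftK D) ≡ + Υ j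
  IsA⇒base g-isA j = begin
    g (γ D j ℤ.- shiftK D)            ≡⟨ cong (λ z → g (z ℤ.- shiftK D)) (ℤₚ.+-identityʳ (γ D j)) ⟨
    g (γ D j ℤ.+ + 0 ℤ.- shiftK D)    ≡⟨ g-isA j (+ 0) ⟩
    + Υ j ℤ.+ + 0                     ≡⟨ ℤₚ.+-identityʳ (+ Υ j) ⟩
    + Υ j                             ∎
    where open ≡-Reasoning

  periodic⇒IsA : (∀ x → g (x ℤ.+ + m) ≡ g x ℤ.+ + r) → (∀ j → g (γ D j ℤ.- shiftK D) ≡ + Υ j) →
                 IsA r D Υ g
  periodic⇒IsA g-periodic g-base j p = begin
    g (γ D j ℤ.+ p ℤ.* + m ℤ.- shiftK D)    ≡⟨ cong g (reorder (γ D j) p (+ m) (shiftK D)) ⟩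
    g (γ D j ℤ.- shiftK D ℤ.+ p ℤ.* + m)    ≡⟨ periodic-+* {σ = g} g-periodic _ p ⟩
    g (γ D j ℤ.- shiftK D) ℤ.+ p ℤ.* + r    ≡⟨ cong (ℤ._+ p ℤ.* + r) (g-base j) ⟩
    + Υ j ℤ.+ p ℤ.* + r                     ∎
    where
    open ≡-Reasoning
    reorder : ∀ c p L k → c ℤ.+ p ℤ.* L ℤ.- k ≡ c ℤ.- k ℤ.+ p ℤ.* L
    reorder = solve-∀

∣∧<⇒≡0 : ∀ {m d} → m ∣ d → d < m → d ≡ 0
∣∧<⇒≡0 {d = zero}  _   _   = refl
∣∧<⇒≡0 {d = suc d} m∣d d<m = contradiction m∣d (>⇒∤ d<m)

module _ {m n : ℕ} (D : DyckPath m n) where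

  private
    m∸i≡[m∸j]+[j∸i] : ∀ {i j} → i ≤ j → j ≤ m → m ∸ i ≡ (m ∸ j) + (j ∸ i)
    m∸i≡[m∸j]+[j∸i] {i} {j} i≤j j≤m =
      trans (cong (_∸ i) (sym (m∸n+n≡m j≤m))) (+-∸-assoc (m ∸ j) i≤j)

  γ≡⇒m*aⱼ≡m*aᵢ+n*[j∸i] : ∀ i j → toℕ i ≤ toℕ j → γ D i ≡ γ D j →
          m * a D j ≡ m * a D i + n * (toℕ j ∸ toℕ i)
  γ≡⇒m*aⱼ≡m*aᵢ+n*[j∸i] i j i≤j γi≡γj = ℤₚ.+-injective (begin
    B                               ≡⟨ recover-B X B C ⟩
    X ℤ.- C ℤ.- γ D j               ≡⟨ cong (λ z → X ℤ.- C ℤ.- z) γi≡γj ⟨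
    X ℤ.- C ℤ.- γ D i               ≡⟨ cong (λ z → X ℤ.- C ℤ.- (X ℤ.- A ℤ.- + z)) split ⟩
    X ℤ.- C ℤ.- (X ℤ.- A ℤ.- (C ℤ.+ E)) ≡⟨ recover-A+E X A C E ⟩
    A ℤ.+ E                         ∎)
    where
    open ≡-Reasoning
    I = toℕ i
    J = toℕ j
    X = + (m * n)
    A = + (m * a D i)
    B = + (m * a D j)
    C = + (n * (m ∸ J))
    E = + (n * (J ∸ I))
    split : n * (m ∸ I) ≡ n * (m ∸ J) + n * (J ∸ I)
    split = trans (cong (n *_) (m∸i≡[m∸j]+[j∸i] i≤j (<⇒≤ (Finₚ.toℕ<n j)))) (*-distribˡ-+ n _ _)
    recover-B : ∀ X B C → B ≡ X ℤ.- C ℤ.- (X ℤ.- B ℤ.- C)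
    recover-B = solve-∀
    recover-A+E : ∀ X A C E → X ℤ.- C ℤ.- (X ℤ.- A ℤ.- (C ℤ.+ E)) ≡ A ℤ.+ E
    recover-A+E = solve-∀

  γ-injective-≤ : Coprime m n → ∀ i j → toℕ i ≤ toℕ j → γ D i ≡ γ D j → toℕ i ≡ toℕ j
  γ-injective-≤ coprime i j i≤j γi≡γj = ≤-antisym i≤j (m∸n≡0⇒m≤n (∣∧<⇒≡0 m∣j∸i j∸i<m))
    where
    m∣j∸i : m ∣ toℕ j ∸ toℕ i
    m∣j∸i = coprime-divisor coprime (∣m+n∣m⇒∣n m∣m*aᵢ+n*[j∸i] (m∣m*n (a D i)))
      where
      m∣m*aᵢ+n*[j∸i] : m ∣ m * a D i + n * (toℕ j ∸ toℕ i)
      m∣m*aᵢ+n*[j∸i] = subst (m ∣_) (γ≡⇒m*aⱼ≡m*aᵢ+n*[j∸i] i j i≤j γi≡γj) (m∣m*n (a D j))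
    j∸i<m : toℕ j ∸ toℕ i < m
    j∸i<m = ≤-<-trans (m∸n≤m (toℕ j) (toℕ i)) (Finₚ.toℕ<n j)

  γ-injective : Coprime m n → ∀ i j → γ D i ≡ γ D j → i ≡ j
  γ-injective coprime i j γi≡γj with ≤-total (toℕ i) (toℕ j)
  ... | inj₁ i≤j = Finₚ.toℕ-injective (γ-injective-≤ coprime i j i≤j γi≡γj)
  ... | inj₂ j≤i = sym (Finₚ.toℕ-injective (γ-injective-≤ coprime j i j≤i (sym γi≡γj)))

  γ-consecutive : .{{NonZero n}} → ∀ {i j} → Consecutive D i j → γ D i ℤ.< γ D j
  γ-consecutive {i} {j} (j≡1+i , aᵢ≡aⱼ) = ℤₚ.≤-<-trans (ℤₚ.≤-reflexive γi≡) shifted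
    where
    X = + (m * n)
    γi≡ : γ D i ≡ X ℤ.- + (m * a D j) ℤ.- + (n * (m ∸ toℕ i))
    γi≡ = cong (λ z → X ℤ.- + (m * z) ℤ.- + (n * (m ∸ toℕ i))) aᵢ≡aⱼ
    [m∸j]<[m∸i] : m ∸ toℕ j < m ∸ toℕ i
    [m∸j]<[m∸i] = ∸-monoʳ-< (subst (toℕ i <_) (sym j≡1+i) (n<1+n (toℕ i))) (<⇒≤ (Finₚ.toℕ<n j))
    shifted : X ℤ.- + (m * a D j) ℤ.- + (n * (m ∸ toℕ i)) ℤ.< γ D j
    shifted = ℤₚ.+-monoʳ-< (X ℤ.- + (m * a D j)) (ℤₚ.neg-mono-< (ℤ.+<+ (*-monoʳ-< n [m∸j]<[m∸i])))

module Standardization {m n r : ℕ} .{{_ : NonZero m}} .{{_ : NonZero n}} .{{_ : NonZero r}}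
  (coprime : Coprime m n) (D : DyckPath m n) (Υ : Fin m → ℕ) (Υ-semistandard : IsSemistandard r D Υ)
  where

  key : Fin m → ℕ × ℤ
  key j = Υ j , γ D j

  _≺_ : Rel (Fin m) 0ℓ
  _≺_ = ×-Lex _≡_ _<_ ℤ._<_ on key

  ≺-isStrictTotalOrder : IsStrictTotalOrder _≡_ _≺_
  ≺-isStrictTotalOrder = injective⇒isStrictTotalOrder
    (×-isStrictTotalOrder <-isStrictTotalOrder ℤₚ.<-isStrictTotalOrder) key
    (λ i j (_ , γi≡γj) → γ-injective D coprime i j γi≡γj)

  open Ranking ≺-isStrictTotalOrder public

  rank-isStdLabel : IsStdLabel D Υ rank
  rank-isStdLabel = rank-range , rank-injective , rank-surjective ,
                    (λ i j Υi<Υj → rank-strictMono (inj₁ Υi<Υj)) ,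
                    (λ i j Υi≡Υj γi<γj → rank-strictMono (inj₂ (Υi≡Υj , γi<γj)))

  isStdLabel⇒≡rank : ∀ ψ → IsStdLabel D Υ ψ → ∀ j → ψ j ≡ rank j
  isStdLabel⇒≡rank ψ (ψ-range , ψ-inj , ψ-surj , ψ-mono₁ , ψ-mono₂) =
    strictMono⇒≡rank ψ ψ-range ψ-inj ψ-surj ψ-mono
    where
    ψ-mono : ∀ {i j} → i ≺ j → ψ i < ψ j
    ψ-mono {i} {j} (inj₁ Υi<Υj)            = ψ-mono₁ i j Υi<Υj
    ψ-mono {i} {j} (inj₂ (Υi≡Υj , γi<γj)) = ψ-mono₂ i j Υi≡Υj γi<γj

  rank-isParkingLabel : IsParkingLabel D rank
  rank-isParkingLabel = rank-range , rank-injective , rank-surjective ,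
                        λ i j consecutive → rank-strictMono (consecutive⇒≺ consecutive)
    where
    consecutive⇒≺ : ∀ {i j} → Consecutive D i j → i ≺ j
    consecutive⇒≺ {i} {j} consecutive with m≤n⇒m<n∨m≡n (proj₂ Υ-semistandard i j consecutive)
    ... | inj₁ Υi<Υj = inj₁ Υi<Υj
    ... | inj₂ Υi≡Υj = inj₂ (Υi≡Υj , γ-consecutive D consecutive)

  module _ (σ : ℤ → ℤ) (σ-std : IsStdPerm r D Υ σ) where

    private
      σ-injective = proj₁ (proj₁ σ-std)
      σ-periodic  = proj₁ (proj₂ (proj₂ (proj₁ σ-std)))
      fw∘σ-isA    = proj₁ (proj₂ σ-std)
      σ-reflects  = proj₂ (proj₂ σ-std)
      Υ-range     = proj₁ Υ-semistandard

    position : Fin m → ℤ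
    position j = γ D j ℤ.- shiftK D

    private
      unshift : ∀ j → position j ℤ.+ shiftK D ≡ γ D j
      unshift j = sub-add (γ D j) (shiftK D)
        where
        sub-add : ∀ z k → z ℤ.- k ℤ.+ k ≡ z
        sub-add = solve-∀

    fw-σ-position : ∀ j → fw m r Υ (σ (position j)) ≡ + Υ j
    fw-σ-position = IsA⇒base D {g = λ x → fw m r Υ (σ x)} fw∘σ-isA

    preimage : ∀ j → ∃ λ t → σ (position j) ≡ + suc t × t < m × fw₀ m r Υ (suc t) ≡ Υ j
    preimage j =
      fw-preimage Υ (σ (position j)) (proj₁ (Υ-range j)) (proj₂ (Υ-range j)) (fw-σ-position j)

    ψ : Fin m → ℕ
    ψ j = suc (proj₁ (preimage j))

    σ-position : ∀ j → σ (position j) ≡ + ψ j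
    σ-position j = proj₁ (proj₂ (preimage j))

    ψ-range : ∀ j → 1 ≤ ψ j × ψ j ≤ m
    ψ-range j = s≤s z≤n , proj₁ (proj₂ (proj₂ (preimage j)))

    fw₀-ψ : ∀ j → fw₀ m r Υ (ψ j) ≡ Υ j
    fw₀-ψ j = proj₂ (proj₂ (proj₂ (preimage j)))

    ψ-injective : ∀ i j → ψ i ≡ ψ j → i ≡ j
    ψ-injective i j ψi≡ψj = γ-injective D coprime i j (begin
      γ D i                       ≡⟨ unshift i ⟨
      position i ℤ.+ shiftK D     ≡⟨ cong (ℤ._+ shiftK D) positions-equal ⟩
      position j ℤ.+ shiftK D     ≡⟨ unshift j ⟩
      γ D j                       ∎)
      where
      open ≡-Reasoning
      positions-equal : position i ≡ position j
      positions-equal =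
        σ-injective _ _ (trans (σ-position i) (trans (cong +_ ψi≡ψj) (sym (σ-position j))))

    ψ-mono-Υ : ∀ i j → Υ i < Υ j → ψ i < ψ j
    ψ-mono-Υ i j Υi<Υj = ≰⇒> λ ψj≤ψi →
      <⇒≱ Υi<Υj (subst₂ _≤_ (fw₀-ψ j) (fw₀-ψ i) (fw₀-mono r Υ ψj≤ψi))

    ψ-mono-γ : ∀ i j → Υ i ≡ Υ j → γ D i ℤ.< γ D j → ψ i < ψ j
    ψ-mono-γ i j Υi≡Υj γi<γj with <-cmp (ψ i) (ψ j)
    ... | tri< ψi<ψj _ _ = ψi<ψj
    ... | tri≈ _ ψi≡ψj _ = contradiction (cong (γ D) (ψ-injective i j ψi≡ψj)) (ℤₚ.<⇒≢ γi<γj)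
    ... | tri> _ _ ψj<ψi = contradiction γj<γi (ℤₚ.<-asym γi<γj)
      where
      σj<σi : σ (position j) ℤ.< σ (position i)
      σj<σi = subst₂ ℤ._<_ (sym (σ-position j)) (sym (σ-position i)) (ℤ.+<+ ψj<ψi)
      fw-σ-equal : fw m r Υ (σ (position j)) ≡ fw m r Υ (σ (position i))
      fw-σ-equal = trans (fw-σ-position j) (trans (cong +_ (sym Υi≡Υj)) (sym (fw-σ-position i)))
      γj<γi : γ D j ℤ.< γ D i
      γj<γi = subst₂ ℤ._<_ (unshift j) (unshift i)
                (ℤₚ.+-monoˡ-< (shiftK D) (σ-reflects _ _ σj<σi fw-σ-equal))

    ψ-isStdLabel : IsStdLabel D Υ ψ
    ψ-isStdLabel = ψ-range , ψ-injective , injective⇒surjective ψ ψ-range ψ-injective ,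
                   ψ-mono-Υ , ψ-mono-γ

    σ-isA : IsA m D rank σ
    σ-isA = periodic⇒IsA D {g = σ} σ-periodic
              (λ j → trans (σ-position j) (cong +_ (isStdLabel⇒≡rank ψ ψ-isStdLabel j)))

mainTheorem10 : (m n r : ℕ) .{{_ : NonZero m}} .{{_ : NonZero n}} .{{_ : NonZero r}} →
    Coprime m n →
    (D : DyckPath m n) (Υ : Fin m → ℕ) → IsSemistandard r D Υ →
    Σ (Fin m → ℕ) λ φ →
      IsStdLabel D Υ φ ×
      (∀ ψ → IsStdLabel D Υ ψ → ∀ j → ψ j ≡ φ j) ×
      IsParkingLabel D φ ×
      (∀ (σ : ℤ → ℤ) → IsStdPerm r D Υ σ → IsA m D φ σ)
mainTheorem10 m n r coprime D Υ Υ-semistandard =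
  rank , rank-isStdLabel , isStdLabel⇒≡rank , rank-isParkingLabel , σ-isA
  where open Standardization coprime D Υ Υ-semistandard
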